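{- Let $G$ be a graph and let $H$ be a connected graph on $k>1$ vertices. Then $\lambda(G,H)\le \lambda(G,K_2)$.
   Context: All graphs are finite and simple. For a graph $G$, $d_v$ denotes the degree of $v$, $u\sim v$ means adjacency, and $\mathrm{vol}(G)=\sum_v d_v$. For a metric space $(X,d)$ and $f:V(G)\to X$ set $R_f(G,X)=\frac{\mathrm{vol}(G)\sum_{u\sim v} d(f(u),f(v))^2}{\sum_{u,v} d(f(u),f(v))^2 d_u d_v}$, where the numerator sum is over edges of $G$ and the denominator sum over unordered pairs of vertices; $\lambda(G,X)=\inf_f R_f(G,X)$ over all $f$ with nonzero denominator. A connected graph $H$ is regarded as the metric space $(V(H),d_H)$ with shortest-path distance, and $\lambda(G,H)=\lambda(G,(V(H),d_H))$. $K_2$ is the graph consisting of a single edge. -}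

module Defs where

open import Data.Nat using (ℕ; zero; suc; _+_; _*_; _<ᵇ_; _≤_; ≢-nonZero)
open import Data.Fin using (Fin; toℕ; _≟_)
open import Data.List using (List; map; allFin)
open import Data.Nat.ListAction using (sum)
open import Data.Bool using (Bool; true; false; if_then_else_; _∧_)
open import Data.Product using (∃; _×_)
open import Data.Integer using (+_)
open import Data.Rational using (ℚ; _/_)
open import Relation.Binary.PropositionalEquality using (_≡_; _≢_)
open import Relation.Nullary.Decidable using (⌊_⌋)

record Graph (n : ℕ) : Set where
  field
    adj    : Fin n → Fin n → Bool
    sym    : ∀ u v → adj u v ≡ adj v u
    irrefl : ∀ u → adj u u ≡ false
open Graph public

Σv : ∀ {n} → (Fin n → ℕ) → ℕ
Σv {n} h = sum (map h (allFin n))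

deg : ∀ {n} → Graph n → Fin n → ℕ
deg G u = Σv (λ v → if adj G u v then 1 else 0)

vol : ∀ {n} → Graph n → ℕ
vol G = Σv (deg G)

data Walk {n : ℕ} (G : Graph n) : Fin n → Fin n → ℕ → Set where
  nil  : ∀ {u} → Walk G u u 0
  cons : ∀ {u w v ℓ} → adj G u w ≡ true → Walk G w v ℓ → Walk G u v (suc ℓ)

Connected : ∀ {n} → Graph n → Set
Connected G = ∀ u v → ∃ λ ℓ → Walk G u v ℓ

IsDist : ∀ {n} → Graph n → Fin n → Fin n → ℕ → Set
IsDist G u v d = Walk G u v d × (∀ ℓ → Walk G u v ℓ → d ≤ ℓ)

K₂ : Graph 2
K₂ = record { adj = λ x y → if ⌊ x ≟ y ⌋ then false else true
            ; sym = s ; irrefl = i }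
  where
  s : ∀ u v → (if ⌊ u ≟ v ⌋ then false else true) ≡ (if ⌊ v ≟ u ⌋ then false else true)
  s Fin.zero Fin.zero = _≡_.refl
  s Fin.zero (Fin.suc Fin.zero) = _≡_.refl
  s (Fin.suc Fin.zero) Fin.zero = _≡_.refl
  s (Fin.suc Fin.zero) (Fin.suc Fin.zero) = _≡_.refl
  i : ∀ u → (if ⌊ u ≟ u ⌋ then false else true) ≡ false
  i Fin.zero = _≡_.refl
  i (Fin.suc Fin.zero) = _≡_.refl

distK₂ : Fin 2 → Fin 2 → ℕ
distK₂ x y = if ⌊ x ≟ y ⌋ then 0 else 1

module _ {n : ℕ} (G : Graph n) {X : Set} (d : X → X → ℕ) (f : Fin n → X) where

  sq : X → X → ℕ
  sq x y = d x y * d x y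

  Numer : ℕ
  Numer = Σv λ u → Σv λ v →
    if (toℕ u <ᵇ toℕ v) ∧ adj G u v then sq (f u) (f v) else 0

  -- Σ over unordered pairs {u,v} (u ≠ v; u = v contributes 0) of d(f u, f v)^2 d_u d_v
  Denom : ℕ
  Denom = Σv λ u → Σv λ v →
    if toℕ u <ᵇ toℕ v then sq (f u) (f v) * deg G u * deg G v else 0

  R : Denom ≢ 0 → ℚ
  R nz = (+ (vol G * Numer)) / Denom
    where instance _ = ≢-nonZero nz

-- A connected H on k > 1 vertices has an edge ab (the first step of a walk between two
-- distinct vertices), and ab spans an isometric copy of K₂ in H. Composing f : V(G) → K₂
-- with 0 ↦ a, 1 ↦ b therefore changes no distance, hence neither the numerator nor the
-- denominator of R_f: every value of R_f(G,K₂) is also a value of R_g(G,H).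
module Submission where

open import Defs
open import Data.Nat using (ℕ; zero; suc; _*_; _<_; s≤s; _<ᵇ_; ≢-nonZero)
open import Data.Nat.Properties using (n≤0⇒n≡0; ≤-pred)
open import Data.Fin using (Fin; toℕ)
open import Data.Bool using (Bool; true; _∧_; if_then_else_)
open import Data.Product using (∃; ∃₂; Σ; _,_)
open import Data.Integer using (+_)
open import Data.Rational using (_≤_; _/_)
open import Data.Rational.Properties using (≤-reflexive)
open import Data.List using (allFin)
open import Data.List.Properties using (map-cong)
open import Data.Nat.ListAction using (sum)
open import Function using (_∘_)
open import Relation.Binary.PropositionalEquality
  using (_≡_; _≢_; refl; cong; cong₂; trans)
  renaming (sym to ≡-sym)

Σv-cong : ∀ {n} {h h′ : Fin n → ℕ} → (∀ u → h u ≡ h′ u) → Σv h ≡ Σv h′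
Σv-cong {n} h≗h′ = cong sum (map-cong h≗h′ (allFin n))

/-cong : ∀ m₁ m₂ d₁ d₂ → m₁ ≡ m₂ → d₁ ≡ d₂ →
         (nz₁ : d₁ ≢ 0) (nz₂ : d₂ ≢ 0) →
         ((+ m₁) / d₁) {{≢-nonZero nz₁}} ≡ ((+ m₂) / d₂) {{≢-nonZero nz₂}}
/-cong _ _ _ _ refl refl _ _ = refl  -- the NonZero instance of _/_ is irrelevant

module _ {n : ℕ} (G : Graph n) {X Y : Set} (dX : X → X → ℕ) (dY : Y → Y → ℕ)
         (φ : X → Y) (isometry : ∀ x y → dY (φ x) (φ y) ≡ dX x y) (f : Fin n → X) where

  private
    sq-∘ : ∀ u v → sq G dY (φ ∘ f) (φ (f u)) (φ (f v)) ≡ sq G dX f (f u) (f v)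
    sq-∘ u v = cong₂ _*_ (isometry (f u) (f v)) (isometry (f u) (f v))

    pairwise : ∀ (P : Fin n → Fin n → Bool) (w : Fin n → Fin n → ℕ → ℕ) →
      Σv (λ u → Σv λ v → if P u v then w u v (sq G dY (φ ∘ f) (φ (f u)) (φ (f v))) else 0) ≡
      Σv (λ u → Σv λ v → if P u v then w u v (sq G dX f (f u) (f v)) else 0)
    pairwise P w = Σv-cong λ u → Σv-cong λ v →
      cong (λ s → if P u v then w u v s else 0) (sq-∘ u v)

  Numer-∘-isometry : Numer G dY (φ ∘ f) ≡ Numer G dX f
  Numer-∘-isometry = pairwise (λ u v → (toℕ u <ᵇ toℕ v) ∧ adj G u v) (λ _ _ s → s)

  Denom-∘-isometry : Denom G dY (φ ∘ f) ≡ Denom G dX f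
  Denom-∘-isometry = pairwise (λ u v → toℕ u <ᵇ toℕ v) (λ u v s → s * deg G u * deg G v)

  R-∘-isometry : (nz : Denom G dX f ≢ 0) →
    Σ (Denom G dY (φ ∘ f) ≢ 0) λ nz′ → R G dY (φ ∘ f) nz′ ≡ R G dX f nz
  R-∘-isometry nz = nz′ , /-cong _ _ _ _ (cong (vol G *_) Numer-∘-isometry) Denom-∘-isometry nz′ nz
    where
    nz′ : Denom G dY (φ ∘ f) ≢ 0
    nz′ = nz ∘ trans (≡-sym Denom-∘-isometry)

module _ {k : ℕ} (H : Graph k) where

  IsDist-refl⇒0 : ∀ {a d} → IsDist H a a d → d ≡ 0
  IsDist-refl⇒0 (_ , minimal) = n≤0⇒n≡0 (minimal 0 nil)

  IsDist-adj⇒1 : ∀ {a b d} → adj H a b ≡ true → IsDist H a b d → d ≡ 1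
  IsDist-adj⇒1 {a} {d = zero} a~b (nil , _) with () ← trans (≡-sym a~b) (irrefl H a)
  IsDist-adj⇒1 {d = suc _} a~b (_ , minimal) =
    cong suc (n≤0⇒n≡0 (≤-pred (minimal 1 (cons a~b nil))))

  Connected⇒edge : Connected H → 1 < k → ∃₂ λ a b → adj H a b ≡ true
  Connected⇒edge conn (s≤s (s≤s _)) with conn Fin.zero (Fin.suc Fin.zero)
  ... | _ , cons {w = b} a~b _ = Fin.zero , b , a~b

  edge-map : Fin k → Fin k → Fin 2 → Fin k
  edge-map a b Fin.zero = a
  edge-map a b (Fin.suc Fin.zero) = b

  edge-map-isometry : ∀ {a b} (dH : Fin k → Fin k → ℕ) → (∀ u v → IsDist H u v (dH u v)) →
    adj H a b ≡ true → ∀ x y → dH (edge-map a b x) (edge-map a b y) ≡ distK₂ x y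
  edge-map-isometry _ isDist a~b Fin.zero Fin.zero = IsDist-refl⇒0 (isDist _ _)
  edge-map-isometry _ isDist a~b Fin.zero (Fin.suc Fin.zero) = IsDist-adj⇒1 a~b (isDist _ _)
  edge-map-isometry {a} {b} _ isDist a~b (Fin.suc Fin.zero) Fin.zero =
    IsDist-adj⇒1 (trans (Graph.sym H b a) a~b) (isDist _ _)
  edge-map-isometry _ isDist a~b (Fin.suc Fin.zero) (Fin.suc Fin.zero) = IsDist-refl⇒0 (isDist _ _)

theorem1p3 : ∀ {n k} (G : Graph n) (H : Graph k) → 1 < k → Connected H →
    (dH : Fin k → Fin k → ℕ) → (∀ u v → IsDist H u v (dH u v)) →
    (f : Fin n → Fin 2) (nzf : Denom G distK₂ f ≢ 0) →
    ∃ λ (g : Fin n → Fin k) → Σ (Denom G dH g ≢ 0) λ nzg →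
      R G dH g nzg ≤ R G distK₂ f nzf
theorem1p3 G H 1<k conn dH isDist f nzf
  with a , b , a~b ← Connected⇒edge H conn 1<k =
  let nzg , R≡ = R-∘-isometry G distK₂ dH (edge-map H a b) (edge-map-isometry H dH isDist a~b) f nzf
  in edge-map H a b ∘ f , nzg , ≤-reflexive R≡
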